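{- Let $t$ be a regular term and $r$ an arbitrary term in the language $\langle\to,\neg,{}^+,{}^-,1\rangle$ of strong quasi-Wajsberg* algebras. Then the equation $(r\to r)\to t\approx t$ is valid in all strong quasi-Wajsberg* algebras.
   Context: A quasi-Wajsberg* algebra is an algebra $\langle W;\to,\neg,{}^+,{}^-,1\rangle$ of type $\langle2,1,1,1,0\rangle$ such that for all $x,y,z$: (QW*1) $x\to y=\neg y\to\neg x$; (QW*2) $(x\to1)\to((y\to1)\to z)=(y\to1)\to((x\to1)\to z)$; (QW*3) $(1\to x)\to1=1$; (QW*4) $(z\to z)\to(x\to y)=x\to y$; (QW*5) $(1\to1)\to x^+=((1\to1)\to x)^+=(x\to1)\to1$ and $(1\to1)\to x^-=((1\to1)\to x)^-=(x\to\neg1)\to\neg1$; (QW*6) $x\to y=(y^+\to x^-)\to(x^+\to y^-)$; (QW*7) $\neg(x\to y)=y\to x$; (QW*8) $\neg\neg x=x$; (QW*9) $(x\to(\neg x\to y))^+=x^+\to(\neg x^+\to y^+)$; (QW*10)–(QW*12) $\vee$ is commutative, associative, and $x\to(y\vee z)=(x\to y)\vee(x\to z)$; where $x\vee y:=((x^+\to y^+)^+\to(\neg x)^-)\to((y^-\to x^-)^-\to x^-)$. It is strong if $x^+=(1\to1)\to x^+$ and $x^-=(1\to1)\to x^-$ for all $x$. A term is regular if it contains an occurrence of $\to$ or of $1$. -}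

module Defs where

open import Data.Nat using (ℕ)
open import Data.Sum using (_⊎_)
open import Data.Empty using (⊥)
open import Data.Unit using (⊤)
open import Relation.Binary.PropositionalEquality using (_≡_)

-- Quasi-Wajsberg* algebra ⟨W; →, ¬, ⁺, ⁻, 1⟩ (→ written _⇒_, ¬ written ∼).
record QWStar : Set₁ where
  infixr 5 _⇒_
  field
    W   : Set
    _⇒_ : W → W → W
    ∼   : W → W
    _⁺  : W → W
    _⁻  : W → W
    𝟏   : W

  _∨_ : W → W → W
  x ∨ y = (((x ⁺ ⇒ y ⁺) ⁺) ⇒ ((∼ x) ⁻)) ⇒ ((((y ⁻ ⇒ x ⁻) ⁻) ⇒ (x ⁻)))

  field
    qw1  : ∀ x y → x ⇒ y ≡ ∼ y ⇒ ∼ x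
    qw2  : ∀ x y z → (x ⇒ 𝟏) ⇒ ((y ⇒ 𝟏) ⇒ z) ≡ (y ⇒ 𝟏) ⇒ ((x ⇒ 𝟏) ⇒ z)
    qw3  : ∀ x → (𝟏 ⇒ x) ⇒ 𝟏 ≡ 𝟏
    qw4  : ∀ x y z → (z ⇒ z) ⇒ (x ⇒ y) ≡ x ⇒ y
    qw5a : ∀ x → (𝟏 ⇒ 𝟏) ⇒ (x ⁺) ≡ ((𝟏 ⇒ 𝟏) ⇒ x) ⁺
    qw5b : ∀ x → ((𝟏 ⇒ 𝟏) ⇒ x) ⁺ ≡ (x ⇒ 𝟏) ⇒ 𝟏
    qw5c : ∀ x → (𝟏 ⇒ 𝟏) ⇒ (x ⁻) ≡ ((𝟏 ⇒ 𝟏) ⇒ x) ⁻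
    qw5d : ∀ x → ((𝟏 ⇒ 𝟏) ⇒ x) ⁻ ≡ (x ⇒ ∼ 𝟏) ⇒ ∼ 𝟏
    qw6  : ∀ x y → x ⇒ y ≡ ((y ⁺) ⇒ (x ⁻)) ⇒ ((x ⁺) ⇒ (y ⁻))
    qw7  : ∀ x y → ∼ (x ⇒ y) ≡ y ⇒ x
    qw8  : ∀ x → ∼ (∼ x) ≡ x
    qw9  : ∀ x y → (x ⇒ (∼ x ⇒ y)) ⁺ ≡ (x ⁺) ⇒ ((∼ (x ⁺)) ⇒ (y ⁺))
    qw10 : ∀ x y → x ∨ y ≡ y ∨ x
    qw11 : ∀ x y z → x ∨ (y ∨ z) ≡ (x ∨ y) ∨ z
    qw12 : ∀ x y z → x ⇒ (y ∨ z) ≡ (x ⇒ y) ∨ (x ⇒ z)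

record IsStrong (A : QWStar) : Set where
  open QWStar A
  field
    strong⁺ : ∀ x → x ⁺ ≡ (𝟏 ⇒ 𝟏) ⇒ (x ⁺)
    strong⁻ : ∀ x → x ⁻ ≡ (𝟏 ⇒ 𝟏) ⇒ (x ⁻)

data Term : Set where
  var  : ℕ → Term
  _`⇒_ : Term → Term → Term
  `∼   : Term → Term
  `⁺   : Term → Term
  `⁻   : Term → Term
  `𝟏   : Term

Regular : Term → Set
Regular (var _)  = ⊥
Regular (_ `⇒ _) = ⊤
Regular (`∼ t)   = Regular t
Regular (`⁺ t)   = Regular t
Regular (`⁻ t)   = Regular t
Regular `𝟏       = ⊤

⟦_⟧ : Term → (A : QWStar) → (ℕ → QWStar.W A) → QWStar.W A
⟦ var n ⟧  A ρ = ρ n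
⟦ s `⇒ t ⟧ A ρ = QWStar._⇒_ A (⟦ s ⟧ A ρ) (⟦ t ⟧ A ρ)
⟦ `∼ t ⟧   A ρ = QWStar.∼ A (⟦ t ⟧ A ρ)
⟦ `⁺ t ⟧   A ρ = QWStar._⁺ A (⟦ t ⟧ A ρ)
⟦ `⁻ t ⟧   A ρ = QWStar._⁻ A (⟦ t ⟧ A ρ)
⟦ `𝟏 ⟧     A ρ = QWStar.𝟏 A

ValidStrong : Term → Term → Set₁
ValidStrong s t = (A : QWStar) → IsStrong A → (ρ : ℕ → QWStar.W A) → ⟦ s ⟧ A ρ ≡ ⟦ t ⟧ A ρ

{-# OPTIONS --safe #-}
module Submission where

open import Defs
open import Data.Product using (∃₂; _,_)
open import Relation.Binary.PropositionalEquality using (_≡_; refl; sym; trans; cong)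

-- Every regular term evaluates to an implication a → b: 1 = (1 → 1) → 1 by QW*3,
-- ¬ (a → b) = b → a by QW*7, and in a strong algebra x⁺ and x⁻ are of the form
-- (1 → 1) → _.  On implications (z → z) → _ is the identity by QW*4.

module _ (A : QWStar) where
  open QWStar A

  IsImplication : W → Set
  IsImplication x = ∃₂ λ a b → x ≡ a ⇒ b

  𝟏-isImplication : IsImplication 𝟏
  𝟏-isImplication = 𝟏 ⇒ 𝟏 , 𝟏 , sym (qw3 𝟏)

  ∼-isImplication : ∀ {x} → IsImplication x → IsImplication (∼ x)
  ∼-isImplication (a , b , x≡a⇒b) = b , a , trans (cong ∼ x≡a⇒b) (qw7 a b)

  ⇒-identityˡ-isImplication : ∀ z {x} → IsImplication x → (z ⇒ z) ⇒ x ≡ x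
  ⇒-identityˡ-isImplication z (a , b , refl) = qw4 a b z

module _ (A : QWStar) (strong : IsStrong A) where
  open QWStar A
  open IsStrong strong

  ⁺-isImplication : ∀ x → IsImplication A (x ⁺)
  ⁺-isImplication x = 𝟏 ⇒ 𝟏 , x ⁺ , strong⁺ x

  ⁻-isImplication : ∀ x → IsImplication A (x ⁻)
  ⁻-isImplication x = 𝟏 ⇒ 𝟏 , x ⁻ , strong⁻ x

  regular-isImplication : ∀ t → Regular t → ∀ ρ → IsImplication A (⟦ t ⟧ A ρ)
  regular-isImplication (s `⇒ u) _   ρ = ⟦ s ⟧ A ρ , ⟦ u ⟧ A ρ , refl
  regular-isImplication `𝟏       _   ρ = 𝟏-isImplication A
  regular-isImplication (`∼ t)   reg ρ = ∼-isImplication A (regular-isImplication t reg ρ)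
  regular-isImplication (`⁺ t)   _   ρ = ⁺-isImplication (⟦ t ⟧ A ρ)
  regular-isImplication (`⁻ t)   _   ρ = ⁻-isImplication (⟦ t ⟧ A ρ)
  regular-isImplication (var _)  ()

proposition3p6 : (t r : Term) → Regular t → ValidStrong ((r `⇒ r) `⇒ t) t
proposition3p6 t r reg A strong ρ =
  ⇒-identityˡ-isImplication A (⟦ r ⟧ A ρ) (regular-isImplication A strong t reg ρ)
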